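{- Let $\mathcal{L}$ be an abstract bi-intuitionistic logic preserved under bi-asimulations and extending $\mathsf{BIL}$, let $(\mathcal{M},w)$ be a bi-unravelled pointed $\Theta$-model, and let $(\mathcal{N},v)$ be a pointed $\Theta_\mathcal{M}$-model with $Th_\mathcal{L}(\mathcal{N},v)=Th_\mathcal{L}([\mathcal{M}],w)$. Then there exists an $\mathcal{L}$-elementary embedding $f$ of $[\mathcal{M}]$ into $\mathcal{N}$ such that $f(w)=v$.
   Context: A signature is a set of propositional letters. A $\Theta$-model is $\mathcal{M}=\langle W,\prec,V\rangle$ with $W\neq\varnothing$, $\prec$ a partial order, $V:\Theta\to 2^W$ monotone along $\prec$; pointed model $(\mathcal{M},w)$, $w\in W$. $BIL(\Theta)$: formulas over $\Theta$ with $\bot,\wedge,\vee,\to,\ll$; $w\models\varphi\to\psi$ iff every $v$ with $w\prec v$ satisfying $\varphi$ satisfies $\psi$; $w\models\varphi\ll\psi$ iff some $v\prec w$ satisfies $\varphi$ but not $\psi$. Abstract bi-intuitionistic logic $\mathcal{L}=(L,\models_\mathcal{L})$: sets $L(\Theta)$ monotone in $\Theta$, satisfaction at pointed $\Theta$-models, isomorphism-invariant, with Expansion (truth unchanged by passing to reducts to a signature containing the formula's letters), Occurrence (each formula has a finite signature), and Closure ($\bot$, $\ll,\to,\wedge,\vee$ available with usual semantics). Extends $\mathsf{BIL}$: $BIL(\Theta)\subseteq L(\Theta)$ with the same meaning. $Th_\mathcal{L}(\mathcal{M},w)$ = (formulas of $L(\Theta)$ true at $(\mathcal{M},w)$, those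 false there). Preserved under bi-asimulations: whenever there is a bi-asimulation from $(\mathcal{M}_1,w_1)$ to $(\mathcal{M}_2,w_2)$, every $L$-formula true at $(\mathcal{M}_1,w_1)$ is true at $(\mathcal{M}_2,w_2)$; here a bi-asimulation is $A\subseteq(W_1\times W_2)\cup(W_2\times W_1)$ with $w_1Aw_2$ such that for $\{i,j\}=\{1,2\}$, $v\in W_i$, $s,t\in W_j$: $vAs$, $v\in V_i(p)$ imply $s\in V_j(p)$; $vAs$, $s\prec_jt$ imply some $u\in W_i$ with $v\prec_iu$, $tAu$, $uAt$; $vAs$, $u\prec_iv$ imply some $t\in W_j$ with $t\prec_js$, $tAu$, $uAt$. An $\mathcal{L}$-elementary embedding of $\Theta$-model $\mathcal{M}$ into $\Theta$-model $\mathcal{N}=\langle U,\lhd,Y\rangle$ is an injective $g:W\to U$ with $v\prec u\iff g(v)\lhd g(u)$ and $Th_\mathcal{L}(\mathcal{M},v)=Th_\mathcal{L}(\mathcal{N},g(v))$ for all $v,u\in W$. Bi-unravelled models: for a pointed model $(\mathcal{K},u)$, $K^{un}_u$ is the set of finite sequences $(u_1,\dots,u_n)$, $n\ge1$, of elements of $\mathcal{K}$ with $u_1=u$ and, for $i<n$, $u_i\ne u_{i+1}$ and $u_i,u_{i+1}$ comparable under $\prec_K$; $\rho$ relates $(u_1..u_n)$ to $(u_1..u_{n+1})$ if $u_n\prec_Ku_{n+1}$, and $(u_1..u_{n+1})$ to $(u_1..u_n)$ if $u_{n+1}\prec_Ku_n$; $\prec^{un}_u$ is the reflexive-transitive closure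 of $\rho$. $(\mathcal{M},w)$ is bi-unravelled iff its frame $\langle W,\prec\rangle$ is (up to frame isomorphism mapping $w$ to $(u)$) $\langle K^{un}_u,\prec^{un}_u\rangle$ for some pointed model $(\mathcal{K},u)$. For a $\Theta$-model $\mathcal{M}$, $\Theta_\mathcal{M}=\Theta\cup\{q^+_v,q^-_v\mid v\in W\}$ with fresh letters, and $[\mathcal{M}]=\langle W,\prec,[V]\rangle$ is the $\Theta_\mathcal{M}$-model agreeing with $V$ on $\Theta$ and with $u\in[V](q^+_v)$ iff $v\prec u$, and $u\notin[V](q^-_v)$ iff $u\prec v$. -}

module Defs where

open import Level using (0ℓ)
open import Data.Empty using (⊥)
open import Data.Product using (Σ; ∃; _×_; _,_)
open import Data.Sum using (_⊎_)
open import Data.List using (List; []; _∷_; _++_) renaming ([_] to ⟦_⟧)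
open import Data.Nat using (ℕ)
open import Data.Fin using (Fin)
open import Relation.Nullary using (¬_)
open import Relation.Binary.PropositionalEquality using (_≡_; _≢_)
open import Relation.Binary.Structures using (IsPartialOrder)
open import Relation.Binary.Construct.Closure.ReflexiveTransitive using (Star)
open import Function using (Injective; _∘_)
open import Function.Bundles using (_⇔_; _↣_; _↔_; Injection; Inverse)
open import Function.Construct.Identity using (↣-id)
open import Function.Construct.Composition using (_↣-∘_)

record Model (Θ : Set) : Set₁ where
  field
    W    : Set
    _≺_  : W → W → Set
    isPO : IsPartialOrder _≡_ _≺_
    V    : Θ → W → Set
    mono : ∀ {p w u} → w ≺ u → V p w → V p u

open Model public

data Form (Θ : Set) : Set where
  atom : Θ → Form Θ
  ⊥'   : Form Θ
  _∧'_ _∨'_ _⇒'_ _≪'_ : Form Θ → Form Θ → Form Θ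

_,_⊨_ : ∀ {Θ} (M : Model Θ) → W M → Form Θ → Set
M , w ⊨ atom p   = V M p w
M , w ⊨ ⊥'       = ⊥
M , w ⊨ (φ ∧' ψ) = (M , w ⊨ φ) × (M , w ⊨ ψ)
M , w ⊨ (φ ∨' ψ) = (M , w ⊨ φ) ⊎ (M , w ⊨ ψ)
M , w ⊨ (φ ⇒' ψ) = ∀ v → _≺_ M w v → M , v ⊨ φ → M , v ⊨ ψ
M , w ⊨ (φ ≪' ψ) = Σ (W M) λ v → _≺_ M v w × (M , v ⊨ φ) × ¬ (M , v ⊨ ψ)

record Iso {Θ : Set} (M N : Model Θ) : Set where
  field
    bij    : W M ↔ W N
  open Inverse bij public using (to)
  field
    pres-≺ : ∀ u v → _≺_ M u v ⇔ _≺_ N (to u) (to v)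
    pres-V : ∀ p u → V M p u ⇔ V N p (to u)

reduct : ∀ {Θ Θ'} → Θ ↣ Θ' → Model Θ' → Model Θ
reduct ι M = record
  { W = W M ; _≺_ = _≺_ M ; isPO = isPO M
  ; V = λ p → V M (Injection.to ι p) ; mono = mono M }

record AbsLogic : Set₁ where
  field
    L    : Set → Set
    -- monotonicity in Θ: L(Θ) ⊆ L(Θ') whenever Θ ⊆ Θ'
    lift    : ∀ {Θ Θ'} → Θ ↣ Θ' → L Θ → L Θ'
    lift-inj : ∀ {Θ Θ'} (ι : Θ ↣ Θ') → Injective _≡_ _≡_ (lift ι)
    lift-id : ∀ {Θ} (φ : L Θ) → lift (↣-id Θ) φ ≡ φ
    lift-∘  : ∀ {Θ Θ' Θ''} (ι : Θ ↣ Θ') (κ : Θ' ↣ Θ'') (φ : L Θ) →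
              lift (κ ↣-∘ ι) φ ≡ lift κ (lift ι φ)
    sat  : ∀ {Θ} (M : Model Θ) → W M → L Θ → Set
    iso-inv : ∀ {Θ} {M N : Model Θ} (i : Iso M N) (w : W M) (φ : L Θ) →
              sat M w φ ⇔ sat N (Iso.to i w) φ
    expansion : ∀ {Θ Θ'} (ι : Θ ↣ Θ') (M : Model Θ') (w : W M) (φ : L Θ) →
                sat M w (lift ι φ) ⇔ sat (reduct ι M) w φ
    -- Occurrence: every formula has a finite signature
    occurrence : ∀ {Θ} (φ : L Θ) →
                 Σ ℕ λ n → Σ (Fin n ↣ Θ) λ ι → Σ (L (Fin n)) λ ψ → lift ι ψ ≡ φ
    ⊥L : ∀ {Θ} → L Θ
    _∧L_ _∨L_ _⇒L_ _≪L_ : ∀ {Θ} → L Θ → L Θ → L Θ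
    sat-⊥ : ∀ {Θ} (M : Model Θ) w → ¬ sat M w ⊥L
    sat-∧ : ∀ {Θ} (M : Model Θ) w φ ψ →
            sat M w (φ ∧L ψ) ⇔ (sat M w φ × sat M w ψ)
    sat-∨ : ∀ {Θ} (M : Model Θ) w φ ψ →
            sat M w (φ ∨L ψ) ⇔ (sat M w φ ⊎ sat M w ψ)
    sat-⇒ : ∀ {Θ} (M : Model Θ) w φ ψ →
            sat M w (φ ⇒L ψ) ⇔ (∀ v → _≺_ M w v → sat M v φ → sat M v ψ)
    sat-≪ : ∀ {Θ} (M : Model Θ) w φ ψ →
            sat M w (φ ≪L ψ) ⇔
              (Σ (W M) λ v → _≺_ M v w × sat M v φ × ¬ sat M v ψ)

open AbsLogic public

record ExtendsBIL (𝓛 : AbsLogic) : Set₁ where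
  field
    embed   : ∀ {Θ} → Form Θ → L 𝓛 Θ
    embed-inj : ∀ {Θ} → Injective _≡_ _≡_ (embed {Θ})
    embed-sat : ∀ {Θ} (M : Model Θ) w (φ : Form Θ) →
                sat 𝓛 M w (embed φ) ⇔ (M , w ⊨ φ)

-- Th_𝓛(M,w) = Th_𝓛(N,v)  (the true parts agree, hence also the false parts)
ThEq : (𝓛 : AbsLogic) {Θ : Set} (M : Model Θ) → W M → (N : Model Θ) → W N → Set
ThEq 𝓛 {Θ} M w N v = ∀ (φ : L 𝓛 Θ) → sat 𝓛 M w φ ⇔ sat 𝓛 N v φ

-- Bi-asimulations.  A ⊆ (W₁×W₂) ∪ (W₂×W₁) is given by its two parts.

record BiAsimHalf {Θ} (Mi Mj : Model Θ)
                  (Aij : W Mi → W Mj → Set) (Aji : W Mj → W Mi → Set) : Set where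
  field
    atoms : ∀ {v s p} → Aij v s → V Mi p v → V Mj p s
    forth : ∀ {v s t} → Aij v s → _≺_ Mj s t →
            Σ (W Mi) λ u → _≺_ Mi v u × Aji t u × Aij u t
    back  : ∀ {v s u} → Aij v s → _≺_ Mi u v →
            Σ (W Mj) λ t → _≺_ Mj t s × Aji t u × Aij u t

record BiAsim {Θ} (M₁ : Model Θ) (w₁ : W M₁) (M₂ : Model Θ) (w₂ : W M₂) : Set₁ where
  field
    A₁₂  : W M₁ → W M₂ → Set
    A₂₁  : W M₂ → W M₁ → Set
    base : A₁₂ w₁ w₂
    half₁₂ : BiAsimHalf M₁ M₂ A₁₂ A₂₁
    half₂₁ : BiAsimHalf M₂ M₁ A₂₁ A₁₂

PreservedUnderBiAsim : AbsLogic → Set₁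
PreservedUnderBiAsim 𝓛 = ∀ {Θ} (M₁ : Model Θ) (w₁ : W M₁) (M₂ : Model Θ) (w₂ : W M₂) →
  BiAsim M₁ w₁ M₂ w₂ → ∀ (φ : L 𝓛 Θ) → sat 𝓛 M₁ w₁ φ → sat 𝓛 M₂ w₂ φ

record ElemEmbedding (𝓛 : AbsLogic) {Θ} (M N : Model Θ) : Set where
  field
    g      : W M → W N
    g-inj  : Injective _≡_ _≡_ g
    g-≺    : ∀ v u → _≺_ M v u ⇔ _≺_ N (g v) (g u)
    g-Th   : ∀ v → ThEq 𝓛 M v N (g v)

-- Bi-unravelling.  An element (u, u₂, …, uₙ) of K^un_u is represented by
-- the list [u₂, …, uₙ] (the head is always u).

module Unravel {K : Set} (_≺K_ : K → K → Set) where

  lastFrom : K → List K → K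
  lastFrom u []       = u
  lastFrom u (x ∷ xs) = lastFrom x xs

  ValidFrom : K → List K → Set
  ValidFrom u []       = Data.Unit.⊤ where import Data.Unit
  ValidFrom u (x ∷ xs) = (u ≢ x) × ((u ≺K x) ⊎ (x ≺K u)) × ValidFrom x xs

  data ρ (u : K) : List K → List K → Set where
    up   : ∀ {xs x} → ValidFrom u xs → ValidFrom u (xs ++ ⟦ x ⟧) →
           lastFrom u xs ≺K x → ρ u xs (xs ++ ⟦ x ⟧)
    down : ∀ {xs x} → ValidFrom u xs → ValidFrom u (xs ++ ⟦ x ⟧) →
           x ≺K lastFrom u xs → ρ u (xs ++ ⟦ x ⟧) xs

  _≺un_ : K → List K → List K → Set
  _≺un_ u = Star (ρ u)

record Frame : Set₁ where
  field
    K    : Set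
    _≺K_ : K → K → Set
    isPOK : IsPartialOrder _≡_ _≺K_

record BiUnravelledVia {Θ} (M : Model Θ) (w : W M) (F : Frame) (u : Frame.K F) : Set where
  open Frame F
  open Unravel _≺K_
  field
    φ       : W M → List K
    φ-valid : ∀ x → ValidFrom u (φ x)
    φ-inj   : Injective _≡_ _≡_ φ
    φ-surj  : ∀ xs → ValidFrom u xs → Σ (W M) λ x → φ x ≡ xs
    φ-≺     : ∀ x y → _≺_ M x y ⇔ _≺un_ u (φ x) (φ y)
    φ-root  : φ w ≡ []

BiUnravelled : ∀ {Θ} (M : Model Θ) → W M → Set₁
BiUnravelled M w = Σ Frame λ F → Σ (Frame.K F) λ u → BiUnravelledVia M w F u

data ExtSig (Θ W : Set) : Set where
  old    : Θ → ExtSig Θ W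
  qplus  : W → ExtSig Θ W
  qminus : W → ExtSig Θ W

Sig[_] : ∀ {Θ} → Model Θ → Set
Sig[_] {Θ} M = ExtSig Θ (W M)

module _ {Θ : Set} (M : Model Θ) where
  private
    _<_ = _≺_ M
    module PO = IsPartialOrder (isPO M)

  [V] : Sig[ M ] → W M → Set
  [V] (old p)    u = V M p u
  [V] (qplus v)  u = v < u
  [V] (qminus v) u = ¬ (u < v)

  [V]-mono : ∀ {p w u} → w < u → [V] p w → [V] p u
  [V]-mono {old p}    w<u h = mono M w<u h
  [V]-mono {qplus v}  w<u h = PO.trans h w<u
  [V]-mono {qminus v} w<u h u<v = h (PO.trans w<u u<v)

  [_] : Model Sig[ M ]
  [_] = record { W = W M ; _≺_ = _<_ ; isPO = isPO M ; V = [V] ; mono = λ {p} → [V]-mono {p} }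

module Submission where

-- Each world m of [M] is named by the letters q⁺_m and q⁻_m: a point y of N
-- with the theory of m satisfies q⁺_m and refutes q⁻_m, which forces every
-- point of N that is ≺-above y to lie above m in [M].  Because BIL has both
-- implication and co-implication, a theory-equal pair (m₀, x) can be extended
-- along any single ≺-step m₀ ≺ m or m ≺ m₀ to a theory-equal pair (m, y) with
-- x ≺ y, resp. y ≺ x.  In a bi-unravelled model every world is reached from
-- w by a unique path of such steps, so choosing the extensions step by step
-- along these paths defines the embedding.

open import Defs
open import Level using (0ℓ)
open import Data.Product using (Σ; _,_; _×_; proj₁; proj₂)
open import Data.Sum using (_⊎_; inj₁; inj₂; [_,_]′)
import Data.Sum as Sum
open import Data.Empty using (⊥-elim)
open import Data.Unit using (tt)
open import Data.List using (List; []; _∷_; _++_) renaming ([_] to ⟦_⟧)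
open import Data.List.Properties using (++-assoc; ++-identityʳ; ++-identityʳ-unique)
open import Relation.Nullary using (¬_; yes; no)
open import Relation.Nullary.Decidable using (decidable-stable)
open import Relation.Binary.PropositionalEquality
  using (_≡_; _≢_; refl; sym; trans; cong; subst; subst₂)
open import Relation.Binary.Structures using (IsPartialOrder)
open import Relation.Binary.Construct.Closure.ReflexiveTransitive using (Star; ε; _◅_)
open import Function.Bundles using (_⇔_; mk⇔; module Equivalence)
import Function.Properties.Equivalence as ⇔
open import Axiom.ExcludedMiddle using (ExcludedMiddle)

open Equivalence using (to; from)

module _ {K : Set} (_≺K_ : K → K → Set) where
  open Unravel _≺K_

  valid-prefix : ∀ {a} xs ys → ValidFrom a (xs ++ ys) → ValidFrom a xs
  valid-prefix []       ys _                 = tt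
  valid-prefix (x ∷ xs) ys (a≢x , a~x , valid) = a≢x , a~x , valid-prefix xs ys valid

  valid-snoc-comparable : ∀ {a} xs {z} → ValidFrom a (xs ++ ⟦ z ⟧) →
                          lastFrom a xs ≺K z ⊎ z ≺K lastFrom a xs
  valid-snoc-comparable []       (_ , a~z , _) = a~z
  valid-snoc-comparable (x ∷ xs) (_ , _ , valid) = valid-snoc-comparable xs valid

  ρ-snoc : ∀ {a} xs {z} → ValidFrom a (xs ++ ⟦ z ⟧) → ρ a xs (xs ++ ⟦ z ⟧) ⊎ ρ a (xs ++ ⟦ z ⟧) xs
  ρ-snoc xs valid = Sum.map (up valid⁻ valid) (down valid⁻ valid) (valid-snoc-comparable xs valid)
    where valid⁻ = valid-prefix xs _ valid

module Choice (em : ExcludedMiddle 0ℓ) {A : Set} (default : A) (P : A → Set) where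

  choose : A
  choose with em {Σ A P}
  ... | yes (a , _) = a
  ... | no _        = default

  choose-spec : Σ A P → P choose
  choose-spec witness with em {Σ A P}
  ... | yes (_ , p) = p
  ... | no none     = ⊥-elim (none witness)

module NamedWorlds (em : ExcludedMiddle 0ℓ) (𝓛 : AbsLogic) (E : ExtendsBIL 𝓛)
  {Θ : Set} (M : Model Θ) (N : Model Sig[ M ]) where

  open ExtendsBIL E

  private
    _<M_ = _≺_ M
    _<N_ = _≺_ N
    module PM = IsPartialOrder (isPO M)
    module PN = IsPartialOrder (isPO N)

    stable : ∀ {P : Set} → ¬ ¬ P → P
    stable = decidable-stable em

    _⊨ᴹ_ : W M → L 𝓛 Sig[ M ] → Set
    m ⊨ᴹ φ = sat 𝓛 [ M ] m φ

    _⊨ᴺ_ : W N → L 𝓛 Sig[ M ] → Set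
    y ⊨ᴺ φ = sat 𝓛 N y φ

    q : Sig[ M ] → L 𝓛 Sig[ M ]
    q p = embed (atom p)

    qᴹ : ∀ {p m} → m ⊨ᴹ q p ⇔ [V] M p m
    qᴹ = embed-sat [ M ] _ (atom _)

    qᴺ : ∀ {p y} → y ⊨ᴺ q p ⇔ V N p y
    qᴺ = embed-sat N _ (atom _)

  TE : W M → W N → Set
  TE m y = ThEq 𝓛 [ M ] m N y

  Named : W M → W N → Set
  Named m y = V N (qplus m) y × ¬ V N (qminus m) y

  ThEq⇒Named : ∀ {m y} → TE m y → Named m y
  ThEq⇒Named {m} te =
    to qᴺ (to (te (q (qplus m))) (from qᴹ PM.refl)) ,
    λ q⁻ → to qᴹ (from (te (q (qminus m))) (from qᴺ q⁻)) PM.refl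

  -- If m ⊭ φ then m ⊨ φ → q⁻_m, since m is the only world above m that is
  -- also below it; at a named y this formula would refute φ.
  Named×forth⇒ThEq : ∀ {m y} → Named m y → (∀ φ → m ⊨ᴹ φ → y ⊨ᴺ φ) → TE m y
  Named×forth⇒ThEq {m} {y} (_ , ¬q⁻) forth φ = mk⇔ (forth φ) back
    where
    back : y ⊨ᴺ φ → m ⊨ᴹ φ
    back yφ = stable λ ¬mφ →
      let φ⇒q⁻ : m ⊨ᴹ _⇒L_ 𝓛 φ (q (qminus m))
          φ⇒q⁻ = from (sat-⇒ 𝓛 [ M ] m _ _) λ z m<z zφ →
            from qᴹ λ z<m → ¬mφ (subst (_⊨ᴹ φ) (PM.antisym z<m m<z) zφ)
      in ¬q⁻ (to qᴺ (to (sat-⇒ 𝓛 N y _ _) (forth _ φ⇒q⁻) y PN.refl yφ))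

  ThEq⇒reflects-≺ : ∀ {m m' x x'} → TE m x → TE m' x' → x <N x' → m <M m'
  ThEq⇒reflects-≺ {m} te te' x<x' =
    to qᴹ (from (te' (q (qplus m))) (from qᴺ (mono N x<x' (proj₁ (ThEq⇒Named te)))))

  ThEq-above : ∀ {m₀ m x} → TE m₀ x → m₀ <M m → Σ (W N) λ y → x <N y × TE m y
  ThEq-above {m₀} {m} {x} te m₀<m =
    let y , x<y , named = named-above in y , x<y , Named×forth⇒ThEq named (forth y x<y named)
    where
    named-above : Σ (W N) λ y → x <N y × Named m y
    named-above = stable λ none →
      let q⁺⇒q⁻ : x ⊨ᴺ embed (atom (qplus m) ⇒' atom (qminus m))
          q⁺⇒q⁻ = from (embed-sat N x _) λ y x<y q⁺ → stable λ ¬q⁻ → none (y , x<y , q⁺ , ¬q⁻)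
      in to (embed-sat [ M ] m₀ _) (from (te _) q⁺⇒q⁻) m m₀<m PM.refl PM.refl

    forth : ∀ y → x <N y → Named m y → ∀ φ → m ⊨ᴹ φ → y ⊨ᴺ φ
    forth y x<y (q⁺ , ¬q⁻) φ mφ =
      [ (λ yφ → yφ) , (λ yq⁻ → ⊥-elim (¬q⁻ (to qᴺ yq⁻))) ]′
        (to (sat-∨ 𝓛 N y _ _) (to (sat-⇒ 𝓛 N x _ _) (to (te _) q⁺⇒φ∨q⁻) y x<y (from qᴺ q⁺)))
      where
      q⁺⇒φ∨q⁻ : m₀ ⊨ᴹ _⇒L_ 𝓛 (q (qplus m)) (_∨L_ 𝓛 φ (q (qminus m)))
      q⁺⇒φ∨q⁻ = from (sat-⇒ 𝓛 [ M ] m₀ _ _) λ z _ zq⁺ → from (sat-∨ 𝓛 [ M ] z _ _)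
        (case-≺ z (to qᴹ zq⁺))
        where
        case-≺ : ∀ z → m <M z → z ⊨ᴹ φ ⊎ z ⊨ᴹ q (qminus m)
        case-≺ z m<z with em {z <M m}
        ... | yes z<m = inj₁ (subst (_⊨ᴹ φ) (PM.antisym m<z z<m) mφ)
        ... | no  z≮m = inj₂ (from qᴹ z≮m)

  ThEq-below : ∀ {m₀ m x} → TE m₀ x → m <M m₀ → Σ (W N) λ y → y <N x × TE m y
  ThEq-below {m₀} {m} {x} te m<m₀ =
    let y , y<x , q⁺ , ¬q⁻ = to (embed-sat N x _) (to (te q⁺≪q⁻) m₀q⁺≪q⁻)
    in y , y<x , Named×forth⇒ThEq (q⁺ , ¬q⁻) (forth y y<x (q⁺ , ¬q⁻))
    where
    q⁺≪q⁻ : L 𝓛 Sig[ M ]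
    q⁺≪q⁻ = embed (atom (qplus m) ≪' atom (qminus m))

    m₀q⁺≪q⁻ : m₀ ⊨ᴹ q⁺≪q⁻
    m₀q⁺≪q⁻ = from (embed-sat [ M ] m₀ _) (m , m<m₀ , PM.refl , λ m≮m → m≮m PM.refl)

    forth : ∀ y → y <N x → Named m y → ∀ φ → m ⊨ᴹ φ → y ⊨ᴺ φ
    forth y y<x (q⁺ , ¬q⁻) φ mφ = stable λ ¬yφ → sat-⊥ 𝓛 N x
      (to (sat-⇒ 𝓛 N x _ _) (to (te _) m₀¬q⁺≪φ∨q⁻) x PN.refl
        (from (sat-≪ 𝓛 N x _ _) (y , y<x , from qᴺ q⁺ , refutes ¬yφ)))
      where
      φ∨q⁻ : L 𝓛 Sig[ M ]
      φ∨q⁻ = _∨L_ 𝓛 φ (q (qminus m))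

      refutes : ¬ y ⊨ᴺ φ → ¬ y ⊨ᴺ φ∨q⁻
      refutes ¬yφ yφ∨q⁻ =
        [ ¬yφ , (λ yq⁻ → ¬q⁻ (to qᴺ yq⁻)) ]′ (to (sat-∨ 𝓛 N y _ _) yφ∨q⁻)

      -- below m₀, only m itself satisfies q⁺_m and refutes q⁻_m
      m₀¬q⁺≪φ∨q⁻ : m₀ ⊨ᴹ _⇒L_ 𝓛 (_≪L_ 𝓛 (q (qplus m)) φ∨q⁻) (⊥L 𝓛)
      m₀¬q⁺≪φ∨q⁻ = from (sat-⇒ 𝓛 [ M ] m₀ _ _) λ z _ zq⁺≪ →
        let t , _ , tq⁺ , ¬tφ∨q⁻ = to (sat-≪ 𝓛 [ M ] z _ _) zq⁺≪
            t<m = stable λ t≮m → ¬tφ∨q⁻ (from (sat-∨ 𝓛 [ M ] t _ _) (inj₂ (from qᴹ t≮m)))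
            t≡m = PM.antisym t<m (to qᴹ tq⁺)
        in ⊥-elim (¬tφ∨q⁻ (from (sat-∨ 𝓛 [ M ] t _ _) (inj₁ (subst (_⊨ᴹ φ) (sym t≡m) mφ))))

  Step : W M → W N → W M → W N → Set
  Step m₀ x m y = TE m y × (m₀ <M m → x <N y) × (m <M m₀ → y <N x)

  Step-exists : ∀ {m₀ m x} → m₀ ≢ m → TE m₀ x → m₀ <M m ⊎ m <M m₀ → Σ (W N) (Step m₀ x m)
  Step-exists m₀≢m te (inj₁ m₀<m) =
    let y , x<y , te' = ThEq-above te m₀<m
    in y , te' , (λ _ → x<y) , (λ m<m₀ → ⊥-elim (m₀≢m (PM.antisym m₀<m m<m₀)))
  Step-exists m₀≢m te (inj₂ m<m₀) =
    let y , y<x , te' = ThEq-below te m<m₀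
    in y , te' , (λ m₀<m → ⊥-elim (m₀≢m (PM.antisym m₀<m m<m₀))) , (λ _ → y<x)

module Unravelling (em : ExcludedMiddle 0ℓ) (𝓛 : AbsLogic) (E : ExtendsBIL 𝓛)
  {Θ : Set} (M : Model Θ) (w : W M) (F : Frame) (u : Frame.K F) (B : BiUnravelledVia M w F u)
  (N : Model Sig[ M ]) (v : W N) (root-ThEq : ThEq 𝓛 [ M ] w N v) where

  open Frame F
  open Unravel _≺K_
  open BiUnravelledVia B renaming (φ to path; φ-valid to path-valid; φ-inj to path-inj;
                                   φ-surj to path-surj; φ-≺ to path-≺; φ-root to path-root)
  open NamedWorlds em 𝓛 E M N

  private
    _<M_ = _≺_ M
    _<N_ = _≺_ N
    module PM = IsPartialOrder (isPO M)
    module PN = IsPartialOrder (isPO N)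

  StepAlong : List K → W N → K → W N → Set
  StepAlong xs x z y = ∀ {m₀ m} → path m₀ ≡ xs → path m ≡ xs ++ ⟦ z ⟧ → Step m₀ x m y

  extend : List K → W N → K → W N
  extend xs x z = Choice.choose em x (StepAlong xs x z)

  trace : List K → W N → List K → W N
  trace xs x []       = x
  trace xs x (z ∷ zs) = trace (xs ++ ⟦ z ⟧) (extend xs x z) zs

  image : List K → W N
  image = trace [] v

  trace-snoc : ∀ xs x ys z → trace xs x (ys ++ ⟦ z ⟧) ≡ extend (xs ++ ys) (trace xs x ys) z
  trace-snoc xs x []       z = cong (λ xs' → extend xs' x z) (sym (++-identityʳ xs))
  trace-snoc xs x (y ∷ ys) z =
    trans (trace-snoc (xs ++ ⟦ y ⟧) (extend xs x y) ys z)
          (cong (λ xs' → extend xs' (trace (xs ++ ⟦ y ⟧) (extend xs x y) ys) z) (++-assoc xs ⟦ y ⟧ ys))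

  ρ⇒≺ : ∀ {m₀ m xs ys} → path m₀ ≡ xs → path m ≡ ys → ρ u xs ys → m₀ <M m
  ρ⇒≺ e₀ e r = from (path-≺ _ _) (subst₂ (Star (ρ u)) (sym e₀) (sym e) (r ◅ ε))

  ThEqPath : List K → W N → Set
  ThEqPath xs y = ∀ {m} → path m ≡ xs → TE m y

  StepAlong-exists : ∀ {xs x z m₀ m} → path m₀ ≡ xs → path m ≡ xs ++ ⟦ z ⟧ →
                     ValidFrom u (xs ++ ⟦ z ⟧) → TE m₀ x → Σ (W N) (StepAlong xs x z)
  StepAlong-exists {xs} {x} {z} {m₀} {m} e₀ e valid te =
    let y , step = Step-exists m₀≢m te comparable
    in y , λ e₀' e' → subst₂ (λ m₀' m' → Step m₀' x m' y)
                        (path-inj (trans e₀ (sym e₀'))) (path-inj (trans e (sym e'))) step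
    where
    m₀≢m : m₀ ≢ m
    m₀≢m m₀≡m with ++-identityʳ-unique xs (trans (sym e₀) (trans (cong path m₀≡m) e))
    ... | ()

    comparable : m₀ <M m ⊎ m <M m₀
    comparable = Sum.map (ρ⇒≺ e₀ e) (ρ⇒≺ e e₀) (ρ-snoc _≺K_ xs valid)

  extend-step : ∀ {xs x z} → ThEqPath xs x → ValidFrom u (xs ++ ⟦ z ⟧) → StepAlong xs x z (extend xs x z)
  extend-step {xs} {x} {z} te valid
    with path-surj xs (valid-prefix _≺K_ xs ⟦ z ⟧ valid) | path-surj (xs ++ ⟦ z ⟧) valid
  ... | _ , e₀ | _ , e = Choice.choose-spec em x _ (StepAlong-exists e₀ e valid (te e₀))

  extend-ThEqPath : ∀ {xs x z} → ThEqPath xs x → ValidFrom u (xs ++ ⟦ z ⟧) → ThEqPath (xs ++ ⟦ z ⟧) (extend xs x z)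
  extend-ThEqPath {xs} te valid e =
    proj₁ (extend-step te valid (proj₂ (path-surj xs (valid-prefix _≺K_ xs _ valid))) e)

  trace-ThEqPath : ∀ zs {xs x} → ThEqPath xs x → ValidFrom u (xs ++ zs) → ThEqPath (xs ++ zs) (trace xs x zs)
  trace-ThEqPath []       {xs} {x} te valid = subst (λ xs' → ThEqPath xs' x) (sym (++-identityʳ xs)) te
  trace-ThEqPath (z ∷ zs) {xs} {x} te valid =
    subst (λ xs' → ThEqPath xs' (trace (xs ++ ⟦ z ⟧) (extend xs x z) zs)) (++-assoc xs ⟦ z ⟧ zs)
      (trace-ThEqPath zs (extend-ThEqPath te valid⁻) valid')
    where
    valid' : ValidFrom u ((xs ++ ⟦ z ⟧) ++ zs)
    valid' = subst (ValidFrom u) (sym (++-assoc xs ⟦ z ⟧ zs)) valid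
    valid⁻ = valid-prefix _≺K_ (xs ++ ⟦ z ⟧) zs valid'

  image-ThEqPath : ∀ {xs} → ValidFrom u xs → ThEqPath xs (image xs)
  image-ThEqPath {xs} = trace-ThEqPath xs root
    where
    root : ThEqPath [] v
    root e m = subst (λ m' → TE m' v) (sym (path-inj (trans e (sym path-root)))) root-ThEq m

  image-ρ : ∀ {xs ys} → ρ u xs ys → image xs <N image ys
  image-ρ r@(up {xs} {z} valid valid⁺ _) =
    subst (image xs <N_) (sym (trace-snoc [] v xs z))
      (proj₁ (proj₂ (extend-step (image-ThEqPath valid) valid⁺ e₀ e)) (ρ⇒≺ e₀ e r))
    where
    e₀ = proj₂ (path-surj xs valid)
    e  = proj₂ (path-surj (xs ++ ⟦ z ⟧) valid⁺)
  image-ρ r@(down {xs} {z} valid valid⁺ _) =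
    subst (_<N image xs) (sym (trace-snoc [] v xs z))
      (proj₂ (proj₂ (extend-step (image-ThEqPath valid) valid⁺ e₀ e)) (ρ⇒≺ e e₀ r))
    where
    e₀ = proj₂ (path-surj xs valid)
    e  = proj₂ (path-surj (xs ++ ⟦ z ⟧) valid⁺)

  image-mono : ∀ {xs ys} → Star (ρ u) xs ys → image xs <N image ys
  image-mono ε        = PN.refl
  image-mono (r ◅ rs) = PN.trans (image-ρ r) (image-mono rs)

  embed-world : W M → W N
  embed-world m = image (path m)

  embed-world-ThEq : ∀ m → TE m (embed-world m)
  embed-world-ThEq m = image-ThEqPath (path-valid m) refl

  embed-world-reflects-≺ : ∀ m m' → embed-world m <N embed-world m' → m <M m'
  embed-world-reflects-≺ m m' = ThEq⇒reflects-≺ (embed-world-ThEq m) (embed-world-ThEq m')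

  embedding : ElemEmbedding 𝓛 [ M ] N
  embedding = record
    { g     = embed-world
    ; g-inj = λ {m} {m'} eq →
        PM.antisym (embed-world-reflects-≺ m m' (subst (embed-world m <N_) eq PN.refl))
                   (embed-world-reflects-≺ m' m (subst (_<N embed-world m) eq PN.refl))
    ; g-≺   = λ m m' → mk⇔ (λ m<m' → image-mono (to (path-≺ m m') m<m'))
                           (embed-world-reflects-≺ m m')
    ; g-Th  = embed-world-ThEq
    }

lemma5p2 : ExcludedMiddle 0ℓ →
    (𝓛 : AbsLogic) → PreservedUnderBiAsim 𝓛 → ExtendsBIL 𝓛 →
    {Θ : Set} (M : Model Θ) (w : W M) → BiUnravelled M w →
    (N : Model Sig[ M ]) (v : W N) → ThEq 𝓛 N v [ M ] w →
    Σ (ElemEmbedding 𝓛 [ M ] N) λ f → ElemEmbedding.g f w ≡ v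
lemma5p2 em 𝓛 _ E M w (F , u , B) N v theories-agree =
  embedding , cong image (BiUnravelledVia.φ-root B)
  where open Unravelling em 𝓛 E M w F u B N v (λ φ → ⇔.sym (theories-agree φ))
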